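{- Let $G$ be a finite simple connected undirected graph on $V=\{1,\dots,n\}$ with $m$ edges, every vertex of degree at least $2$, and $G$ not a cycle, and suppose the NBRW on $G$ has locally uniform return time. Then \[ M^{(nb)}_{ev}=J_{2m,n}+P_{nb}M^{(nb)}_{ev}-T^\top R. \]
   Context: $d_i=\deg(i)$. Directed edges: the $2m$ ordered pairs $(i,j)$ with $\{i,j\}$ an edge. $P_{nb}$ is the $2m\times2m$ matrix with $P_{nb}((i,j),(k,\ell))=\frac1{d_j-1}$ if $j=k,\ell\ne i$, else $0$. $T$ ($n\times 2m$): $T(x,(i,j))=1$ iff $i=x$. $J_{2m,n}$ is the $2m\times n$ all-ones matrix. The NBRW on vertices is $(\tilde X_k)_{k\ge0}$ with $\tilde X_1$ a uniform neighbor of $\tilde X_0$ and, for $k\ge1$, $\tilde X_{k+1}$ uniform among neighbors of $\tilde X_k$ other than $\tilde X_{k-1}$. Let $\tilde T_v=\min\{k\ge0:\tilde X_k=v\}$ and $\tilde T_v^+=\min\{k\ge1:\tilde X_k=v\}$. $M^{(nb)}_{ev}$ is the $2m\times n$ matrix with $(M^{(nb)}_{ev})_{(i,j),v}=\mathbb E[\tilde T_v\mid \tilde X_0=i,\tilde X_1=j]$. $R$ is the $n\times n$ diagonal matrix with $R_{ii}=\mathbb E[\tilde T_i^+\mid\tilde X_0=i]$. The NBRW has locally uniform return time if for every vertex $i$, $\mathbb E[\tilde T_i^+\mid \tilde X_0=i,\tilde X_1=j]$ does not depend on the neighbor $j$ of $i$. -}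

module Defs where

open import Data.Nat as ℕ using (ℕ; zero; suc; _∸_)
open import Data.Fin using (Fin; zero; suc; toℕ)
open import Data.Fin.Properties using () renaming (_≟_ to _≟ᶠ_)
open import Data.Bool using (Bool; true; false; if_then_else_)
open import Data.Vec using (Vec; []; _∷_)
open import Data.Integer using (+_)
open import Data.Rational using (ℚ; 0ℚ; 1ℚ; _+_; _*_; _-_; _/_; _<_; ∣_∣)
open import Data.Product using (Σ; _×_; ∃)
open import Data.Sum using (_⊎_)
open import Relation.Nullary using (yes; no; ¬_)
open import Relation.Binary.PropositionalEquality using (_≡_)
open import Function.Definitions using (Injective)
open import Function.Bundles using (_⇔_)

Adj : ℕ → Set
Adj n = Fin n → Fin n → Bool

record IsSimpleGraph {n : ℕ} (A : Adj n) : Set where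
  field
    symmetric   : ∀ i j → A i j ≡ A j i
    irreflexive : ∀ i → A i i ≡ false

Σℕ : ∀ {n} → (Fin n → ℕ) → ℕ
Σℕ {zero}  f = 0
Σℕ {suc n} f = f zero ℕ.+ Σℕ (λ i → f (suc i))

Σℚ : ∀ {n} → (Fin n → ℚ) → ℚ
Σℚ {zero}  f = 0ℚ
Σℚ {suc n} f = f zero + Σℚ (λ i → f (suc i))

ΣVec : ∀ {n} (r : ℕ) → (Vec (Fin n) r → ℚ) → ℚ
ΣVec zero    f = f []
ΣVec (suc r) f = Σℚ (λ x → ΣVec r (λ xs → f (x ∷ xs)))

partial : (ℕ → ℚ) → ℕ → ℚ
partial s zero    = 0ℚ
partial s (suc K) = partial s K + s K

deg : ∀ {n} → Adj n → Fin n → ℕ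
deg A i = Σℕ (λ j → if A i j then 1 else 0)

data Reach {n} (A : Adj n) : Fin n → Fin n → Set where
  here : ∀ {i} → Reach A i i
  step : ∀ {i j k} → A i j ≡ true → Reach A j k → Reach A i k

Connected : ∀ {n} → Adj n → Set
Connected A = ∀ i j → Reach A i j

Consec : (n : ℕ) → ℕ → ℕ → Set
Consec n a b = (b ≡ suc a) ⊎ ((a ≡ n ∸ 1) × (b ≡ 0))

IsCycle : ∀ {n} → Adj n → Set
IsCycle {n} A =
  (3 ℕ.≤ n) × Σ (Fin n → Fin n) (λ σ → Injective _≡_ _≡_ σ ×
    (∀ i j → (A i j ≡ true) ⇔ (Consec n (toℕ (σ i)) (toℕ (σ j)) ⊎ Consec n (toℕ (σ j)) (toℕ (σ i)))))

-- 1/k  (0 when k = 0; never used in that case under min-degree ≥ 2)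
inv : ℕ → ℚ
inv zero    = 0ℚ
inv (suc k) = (+ 1) / (suc k)

ind : Bool → ℚ
ind true  = 1ℚ
ind false = 0ℚ

neq : ∀ {n} → Fin n → Fin n → ℚ
neq x y with x ≟ᶠ y
... | yes _ = 0ℚ
... | no  _ = 1ℚ

eqℚ : ∀ {n} → Fin n → Fin n → ℚ
eqℚ x y with x ≟ᶠ y
... | yes _ = 1ℚ
... | no  _ = 0ℚ

-- Matrices indexed by directed edges (i,j) (rows with A i j ≡ true)

Pnb : ∀ {n} → Adj n → Fin n → Fin n → Fin n → Fin n → ℚ
Pnb A i j k l = eqℚ j k * neq l i * inv (deg A j ∸ 1)

PnbMul : ∀ {n} → Adj n → (Fin n → Fin n → Fin n → ℚ) → Fin n → Fin n → Fin n → ℚ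
PnbMul A M i j v = Σℚ (λ k → Σℚ (λ l → ind (A k l) * (Pnb A i j k l * M k l v)))

Tmat : ∀ {n} → Fin n → Fin n → Fin n → ℚ
Tmat x i j = eqℚ i x

-- (Tᵀ R)((i,j),v) = Σ_x T(x,(i,j)) R(x,v), R diagonal with diagonal entries r
TtR : ∀ {n} → (Fin n → ℚ) → Fin n → Fin n → Fin n → ℚ
TtR r i j v = Σℚ (λ x → Tmat x i j * (eqℚ x v * r x))

q : ∀ {n} → Adj n → Fin n → Fin n → Fin n → ℚ
q A prev cur l = ind (A cur l) * neq l prev * inv (deg A cur ∸ 1)

-- probability that, given X_{t-1} = prev, X_t = cur, the next vertices are xs
pathProb : ∀ {n} {r} → Adj n → Fin n → Fin n → Vec (Fin n) r → ℚ
pathProb A prev cur []       = 1ℚ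
pathProb A prev cur (l ∷ xs) = q A prev cur l * pathProb A cur l xs

avoid : ∀ {n} {r} → Fin n → Vec (Fin n) r → ℚ
avoid v []       = 1ℚ
avoid v (x ∷ xs) = neq x v * avoid v xs

-- P(X_1,…,X_k all ≠ v | X_0 = i, X_1 = j)   (k ≥ 1; equals 1 for k = 0)
avoidFrom1 : ∀ {n} → Adj n → Fin n → Fin n → Fin n → ℕ → ℚ
avoidFrom1 A i j v zero    = 1ℚ
avoidFrom1 A i j v (suc r) =
  neq j v * ΣVec r (λ xs → pathProb A i j xs * avoid v xs)

-- P(T_v > k | X_0 = i, X_1 = j) = P(X_0,…,X_k all ≠ v | X_0 = i, X_1 = j)
survHit : ∀ {n} → Adj n → Fin n → Fin n → Fin n → ℕ → ℚ
survHit A i j v k = neq i v * avoidFrom1 A i j v k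

-- P(T_i^+ > k | X_0 = i, X_1 = j) = P(X_1,…,X_k all ≠ i | X_0 = i, X_1 = j)
survRet : ∀ {n} → Adj n → Fin n → Fin n → ℕ → ℚ
survRet A i j k = avoidFrom1 A i j i k

-- P(T_i^+ > k | X_0 = i) : X_1 uniform among the neighbours of i
survRet₀ : ∀ {n} → Adj n → Fin n → ℕ → ℚ
survRet₀ A i k = Σℚ (λ j → ind (A i j) * inv (deg A i) * survRet A i j k)

ConvergesTo : (ℕ → ℚ) → ℚ → Set
ConvergesTo s L = ∀ (ε : ℚ) → 0ℚ < ε → ∃ λ N → ∀ k → N ℕ.≤ k → ∣ s k - L ∣ < ε

-- E[Y] = L for Y ≥ 0 integer-valued with tail probabilities P(Y > k) = tail k
ExpectationIs : (ℕ → ℚ) → ℚ → Set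
ExpectationIs tail L = ConvergesTo (partial tail) L

LocallyUniformReturn : ∀ {n} → Adj n → Set
LocallyUniformReturn {n} A =
  ∀ (i : Fin n) → ∃ λ (c : ℚ) → ∀ (j : Fin n) → A i j ≡ true → ExpectationIs (survRet A i j) c

-- First-step analysis of the non-backtracking walk. Conditioning on the step out of the
-- directed edge (i,j), the tails satisfy
--   P(T_v > k+1 | i,j) = [i ≠ v] Σ_l P_nb((i,j),(j,l)) P(T_v > k | j,l),
-- where minimum degree 2 makes the step kernel stochastic; summing over k gives
-- M((i,j),v) = [i ≠ v] (1 + (P_nb M)((i,j),v)). The same step for the return time gives
-- E[T_i^+ | i,j] = 1 + (P_nb M)((i,j),i). Local uniformity makes this number the same for
-- every neighbour j, so it is also the average R_ii over j, and the [i = v] defect of the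
-- first identity is exactly (Tᵀ R)((i,j),v).
module Submission where

open import Defs
open import Data.Nat using (ℕ; _≤_)
open import Data.Fin using (Fin)
open import Data.Bool using (true)
open import Data.Rational using (ℚ; 1ℚ; _+_; _-_)
open import Relation.Nullary using (¬_)
open import Relation.Binary.PropositionalEquality using (_≡_)

open import Algebra.Bundles using (CommutativeRing)
open import Data.Bool using (false; if_then_else_)
open import Data.Empty using (⊥-elim)
open import Data.Fin using (zero; suc)
open import Data.Fin.Properties using () renaming (_≟_ to _≟ᶠ_)
import Data.Integer as ℤ
import Data.Integer.Properties as ℤₚ
open import Data.Nat using (zero; suc; _∸_; _⊔_)
import Data.Nat as Nat
import Data.Nat.Properties as ℕₚ
open import Data.Nat.Coprimality using (1-coprimeTo)
open import Data.Product using (_,_; proj₂)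
open import Data.Rational
  using (0ℚ; _*_; ∣_∣; _<_; ½; _/_; 1/_; Positive; NonZero; ≢-nonZero)
open import Data.Rational.Literals using (fromℤ)
open import Data.Rational.Properties
open import Data.Vec using (Vec; []; _∷_)
open import Data.Sum using (_⊎_; inj₁; inj₂)
open import Function using (_∘_)
open import Level using (0ℓ)
open import Relation.Binary.PropositionalEquality
  using (_≢_; refl; sym; trans; cong; cong₂; subst; module ≡-Reasoning)
open import Relation.Nullary using (yes; no; Dec)
open import Relation.Nullary.Decidable using (dec⇒maybe)
open import Tactic.RingSolver using (solve-∀)
open import Tactic.RingSolver.Core.AlmostCommutativeRing
  using (AlmostCommutativeRing; fromCommutativeRing)
open import Algebra.Properties.Group +-0-group using (x∙y⁻¹≈ε⇒x≈y)
open import Algebra.Properties.Semiring.Sum (CommutativeRing.semiring +-*-commutativeRing)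
  using (sum; ∑-distrib-+; *-distribˡ-sum)

ℚ-ring : AlmostCommutativeRing 0ℓ 0ℓ
ℚ-ring = fromCommutativeRing +-*-commutativeRing (λ x → dec⇒maybe (0ℚ ≟ x))

∣p∣-positive : ∀ {p} → p ≢ 0ℚ → Positive ∣ p ∣
∣p∣-positive {p} p≢0 =
  nonNeg∧nonZero⇒pos ∣ p ∣ {{∣-∣-nonNeg p}} {{≢-nonZero (p≢0 ∘ ∣p∣≡0⇒p≡0 p)}}

half+half : ∀ ε → ε * ½ + ε * ½ ≡ ε
half+half = solve-∀ ℚ-ring

eqℚ-refl : ∀ {n} (x : Fin n) → eqℚ x x ≡ 1ℚ
eqℚ-refl x with x ≟ᶠ x
... | yes _  = refl
... | no x≢x = ⊥-elim (x≢x refl)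

eqℚ-≢ : ∀ {n} {x y : Fin n} → x ≢ y → eqℚ x y ≡ 0ℚ
eqℚ-≢ {x = x} {y} x≢y with x ≟ᶠ y
... | yes x≡y = ⊥-elim (x≢y x≡y)
... | no _    = refl

eqℚ-suc : ∀ {n} (x y : Fin n) → eqℚ (suc x) (suc y) ≡ eqℚ x y
eqℚ-suc x y with x ≟ᶠ y
... | yes refl = refl
... | no _     = refl

neq-refl : ∀ {n} (x : Fin n) → neq x x ≡ 0ℚ
neq-refl x with x ≟ᶠ x
... | yes _  = refl
... | no x≢x = ⊥-elim (x≢x refl)

neq-≢ : ∀ {n} {x y : Fin n} → x ≢ y → neq x y ≡ 1ℚ
neq-≢ {x = x} {y} x≢y with x ≟ᶠ y
... | yes x≡y = ⊥-elim (x≢y x≡y)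
... | no _    = refl

neq*f≡f-eqℚ*f : ∀ {n} (i v : Fin n) (f : Fin n → ℚ) → neq i v * f v ≡ f v - eqℚ i v * f i
neq*f≡f-eqℚ*f i v f with i ≟ᶠ v
... | yes refl = begin
  0ℚ * f i           ≡⟨ *-zeroˡ (f i) ⟩
  0ℚ                 ≡⟨ +-inverseʳ (f i) ⟨
  f i - f i          ≡⟨ cong (λ x → f i - x) (*-identityˡ (f i)) ⟨
  f i - 1ℚ * f i     ∎
  where open ≡-Reasoning
... | no _     = begin
  1ℚ * f v           ≡⟨ *-identityˡ (f v) ⟩
  f v                ≡⟨ +-identityʳ (f v) ⟨
  f v - 0ℚ           ≡⟨ cong (λ x → f v - x) (*-zeroˡ (f i)) ⟨
  f v - 0ℚ * f i     ∎
  where open ≡-Reasoning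

Σℚ≡sum : ∀ {n} (f : Fin n → ℚ) → Σℚ f ≡ sum f
Σℚ≡sum {zero}  f = refl
Σℚ≡sum {suc n} f = cong (f zero +_) (Σℚ≡sum (f ∘ suc))

Σℚ-cong : ∀ {n} {f g : Fin n → ℚ} → (∀ x → f x ≡ g x) → Σℚ f ≡ Σℚ g
Σℚ-cong {zero}  f≗g = refl
Σℚ-cong {suc n} f≗g = cong₂ _+_ (f≗g zero) (Σℚ-cong (f≗g ∘ suc))

Σℚ-zero : ∀ {n} {f : Fin n → ℚ} → (∀ x → f x ≡ 0ℚ) → Σℚ f ≡ 0ℚ
Σℚ-zero {zero}  f≗0 = refl
Σℚ-zero {suc n} f≗0 = cong₂ _+_ (f≗0 zero) (Σℚ-zero (f≗0 ∘ suc))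

Σℚ-distrib-+ : ∀ {n} (f g : Fin n → ℚ) → Σℚ (λ x → f x + g x) ≡ Σℚ f + Σℚ g
Σℚ-distrib-+ f g
  rewrite Σℚ≡sum (λ x → f x + g x) | Σℚ≡sum f | Σℚ≡sum g = ∑-distrib-+ f g

*-distribˡ-Σℚ : ∀ {n} c (f : Fin n → ℚ) → c * Σℚ f ≡ Σℚ (λ x → c * f x)
*-distribˡ-Σℚ c f rewrite Σℚ≡sum f | Σℚ≡sum (λ x → c * f x) = *-distribˡ-sum c f

Σℚ-δ : ∀ {n} (j : Fin n) (f : Fin n → ℚ) → Σℚ (λ k → eqℚ j k * f k) ≡ f j
Σℚ-δ zero f = begin
  1ℚ * f zero + Σℚ (λ k → 0ℚ * f (suc k)) ≡⟨ cong₂ _+_ (*-identityˡ (f zero)) (Σℚ-zero (*-zeroˡ ∘ f ∘ suc)) ⟩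
  f zero + 0ℚ                              ≡⟨ +-identityʳ (f zero) ⟩
  f zero                                   ∎
  where open ≡-Reasoning
Σℚ-δ (suc j) f = begin
  0ℚ * f zero + Σℚ (λ k → eqℚ (suc j) (suc k) * f (suc k))
      ≡⟨ cong₂ _+_ (*-zeroˡ (f zero)) (Σℚ-cong λ k → cong (_* f (suc k)) (eqℚ-suc j k)) ⟩
  0ℚ + Σℚ (λ k → eqℚ j k * f (suc k))
      ≡⟨ +-identityˡ _ ⟩
  Σℚ (λ k → eqℚ j k * f (suc k))
      ≡⟨ Σℚ-δ j (f ∘ suc) ⟩
  f (suc j) ∎
  where open ≡-Reasoning

Σℚ-except : ∀ {n} (f : Fin n → ℚ) (i : Fin n) → Σℚ (λ l → f l * neq l i) ≡ Σℚ f - f i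
Σℚ-except f i = begin
  S≠i
      ≡⟨ x≡x+y-y S≠i (f i) ⟩
  S≠i + f i - f i
      ≡⟨ cong (λ z → S≠i + z - f i) (Σℚ-δ i f) ⟨
  S≠i + Σℚ (λ l → eqℚ i l * f l) - f i
      ≡⟨ cong (_- f i) (Σℚ-distrib-+ (λ l → f l * neq l i) (λ l → eqℚ i l * f l)) ⟨
  Σℚ (λ l → f l * neq l i + eqℚ i l * f l) - f i
      ≡⟨ cong (_- f i) (Σℚ-cong split) ⟩
  Σℚ f - f i ∎
  where
  open ≡-Reasoning
  S≠i : ℚ
  S≠i = Σℚ (λ l → f l * neq l i)
  x≡x+y-y : ∀ x y → x ≡ x + y - y
  x≡x+y-y = solve-∀ ℚ-ring
  split : ∀ l → f l * neq l i + eqℚ i l * f l ≡ f l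
  split l = by-cases (l ≟ᶠ i)
    where
    by-cases : Dec (l ≡ i) → f l * neq l i + eqℚ i l * f l ≡ f l
    by-cases (yes refl) = begin
      f l * neq l l + eqℚ l l * f l ≡⟨ cong₂ (λ a b → f l * a + b * f l) (neq-refl l) (eqℚ-refl l) ⟩
      f l * 0ℚ + 1ℚ * f l           ≡⟨ cong₂ _+_ (*-zeroʳ (f l)) (*-identityˡ (f l)) ⟩
      0ℚ + f l                      ≡⟨ +-identityˡ (f l) ⟩
      f l                           ∎
    by-cases (no l≢i) = begin
      f l * neq l i + eqℚ i l * f l ≡⟨ cong₂ (λ a b → f l * a + b * f l) (neq-≢ l≢i) (eqℚ-≢ (l≢i ∘ sym)) ⟩
      f l * 1ℚ + 0ℚ * f l           ≡⟨ cong₂ _+_ (*-identityʳ (f l)) (*-zeroˡ (f l)) ⟩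
      f l + 0ℚ                      ≡⟨ +-identityʳ (f l) ⟩
      f l                           ∎

ΣVec-cong : ∀ {n} r {f g : Vec (Fin n) r → ℚ} → (∀ xs → f xs ≡ g xs) → ΣVec r f ≡ ΣVec r g
ΣVec-cong zero    f≗g = f≗g []
ΣVec-cong (suc r) f≗g = Σℚ-cong λ x → ΣVec-cong r (f≗g ∘ (x ∷_))

*-distribˡ-ΣVec : ∀ {n} r c (f : Vec (Fin n) r → ℚ) → c * ΣVec r f ≡ ΣVec r (λ xs → c * f xs)
*-distribˡ-ΣVec zero    c f = refl
*-distribˡ-ΣVec (suc r) c f =
  trans (*-distribˡ-Σℚ c (λ x → ΣVec r (f ∘ (x ∷_)))) (Σℚ-cong λ x → *-distribˡ-ΣVec r c (f ∘ (x ∷_)))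

fromℕ : ℕ → ℚ
fromℕ k = fromℤ (ℤ.+ k)

fromℕ-suc : ∀ k → fromℕ (suc k) ≡ 1ℚ + fromℕ k
-- `1ℚ + fromℕ k` computes to `(+ 1 + + k * + 1) / 1`.
fromℕ-suc k = sym (trans (cong (λ z → (ℤ.+ 1 ℤ.+ z) / 1) (ℤₚ.*-identityʳ (ℤ.+ k))) (normalize-coprime _))

fromℕ-+ : ∀ a b → fromℕ (a Nat.+ b) ≡ fromℕ a + fromℕ b
fromℕ-+ zero    b = sym (+-identityˡ (fromℕ b))
fromℕ-+ (suc a) b = begin
  fromℕ (suc a Nat.+ b)         ≡⟨ fromℕ-suc (a Nat.+ b) ⟩
  1ℚ + fromℕ (a Nat.+ b)        ≡⟨ cong (1ℚ +_) (fromℕ-+ a b) ⟩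
  1ℚ + (fromℕ a + fromℕ b)      ≡⟨ +-assoc 1ℚ (fromℕ a) (fromℕ b) ⟨
  1ℚ + fromℕ a + fromℕ b        ≡⟨ cong (_+ fromℕ b) (fromℕ-suc a) ⟨
  fromℕ (suc a) + fromℕ b       ∎
  where open ≡-Reasoning

fromℕ-pred : ∀ d → 1 ≤ d → fromℕ (d ∸ 1) ≡ fromℕ d - 1ℚ
fromℕ-pred (suc d) _ = trans (x≡1+x-1 (fromℕ d)) (cong (_- 1ℚ) (sym (fromℕ-suc d)))
  where
  x≡1+x-1 : ∀ x → x ≡ 1ℚ + x - 1ℚ
  x≡1+x-1 = solve-∀ ℚ-ring

fromℕ-Σℕ : ∀ {n} (f : Fin n → ℕ) → fromℕ (Σℕ f) ≡ Σℚ (fromℕ ∘ f)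
fromℕ-Σℕ {zero}  f = refl
fromℕ-Σℕ {suc n} f = trans (fromℕ-+ (f zero) _) (cong (fromℕ (f zero) +_) (fromℕ-Σℕ (f ∘ suc)))

Σℚ-ind≡deg : ∀ {n} (A : Adj n) i → Σℚ (λ l → ind (A i l)) ≡ fromℕ (deg A i)
Σℚ-ind≡deg A i =
  sym (trans (fromℕ-Σℕ (λ l → if A i l then 1 else 0)) (Σℚ-cong (fromℕ-indicator ∘ A i)))
  where
  fromℕ-indicator : ∀ b → fromℕ (if b then 1 else 0) ≡ ind b
  fromℕ-indicator true  = refl
  fromℕ-indicator false = refl

inv-*-fromℕ : ∀ d → 1 ≤ d → inv d * fromℕ d ≡ 1ℚ
inv-*-fromℕ (suc d) _ =
  trans (cong (_* fromℕ (suc d)) (normalize-coprime (1-coprimeTo (suc d)))) (*-inverseˡ (fromℕ (suc d)))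

ConvergesTo-cong : ∀ {s t : ℕ → ℚ} {a} → (∀ k → s k ≡ t k) → ConvergesTo s a → ConvergesTo t a
ConvergesTo-cong {a = a} s≗t s→a ε ε>0 =
  let N , close = s→a ε ε>0
  in N , λ k N≤k → subst (λ x → ∣ x - a ∣ < ε) (s≗t k) (close k N≤k)

ConvergesTo-const : ∀ a → ConvergesTo (λ _ → a) a
ConvergesTo-const a ε ε>0 = 0 , λ _ _ → subst (λ x → ∣ x ∣ < ε) (sym (+-inverseʳ a)) ε>0

ConvergesTo-suc : ∀ {s a} → ConvergesTo s a → ConvergesTo (s ∘ suc) a
ConvergesTo-suc s→a ε ε>0 =
  let N , close = s→a ε ε>0
  in N , λ k N≤k → close (suc k) (ℕₚ.m≤n⇒m≤1+n N≤k)

ConvergesTo-+ : ∀ {s t a b} → ConvergesTo s a → ConvergesTo t b →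
  ConvergesTo (λ k → s k + t k) (a + b)
ConvergesTo-+ {s} {t} {a} {b} s→a t→b ε ε>0 =
  let N₁ , close₁ = s→a (ε * ½) ε/2>0
      N₂ , close₂ = t→b (ε * ½) ε/2>0
  in N₁ ⊔ N₂ , λ k N≤k → begin-strict
    ∣ (s k + t k) - (a + b) ∣    ≡⟨ cong ∣_∣ (regroup (s k) (t k) a b) ⟩
    ∣ (s k - a) + (t k - b) ∣    ≤⟨ ∣p+q∣≤∣p∣+∣q∣ (s k - a) (t k - b) ⟩
    ∣ s k - a ∣ + ∣ t k - b ∣    <⟨ +-mono-< (close₁ k (ℕₚ.m⊔n≤o⇒m≤o N₁ N₂ N≤k))
                                              (close₂ k (ℕₚ.m⊔n≤o⇒n≤o N₁ N₂ N≤k)) ⟩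
    ε * ½ + ε * ½                ≡⟨ half+half ε ⟩
    ε                            ∎
  where
  open ≤-Reasoning
  ε/2>0 : 0ℚ < ε * ½
  ε/2>0 = *-monoˡ-<-pos ½ ε>0
  regroup : ∀ x y u v → (x + y) - (u + v) ≡ (x - u) + (y - v)
  regroup = solve-∀ ℚ-ring

ConvergesTo-0* : ∀ (s : ℕ → ℚ) a → ConvergesTo (λ k → 0ℚ * s k) (0ℚ * a)
ConvergesTo-0* s a =
  ConvergesTo-cong (λ k → trans (*-zeroˡ a) (sym (*-zeroˡ (s k)))) (ConvergesTo-const (0ℚ * a))

ConvergesTo-*ˡ : ∀ {s a} c → ConvergesTo s a → ConvergesTo (λ k → c * s k) (c * a)
ConvergesTo-*ˡ {s} {a} c s→a with c ≟ 0ℚ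
... | yes refl = ConvergesTo-0* s a
... | no c≢0 = λ ε ε>0 →
  let N , close = s→a (ε * 1/ ∣ c ∣) (subst (_< ε * 1/ ∣ c ∣) (*-zeroˡ (1/ ∣ c ∣))
                                               (*-monoˡ-<-pos (1/ ∣ c ∣) ε>0))
  in N , λ k N≤k → begin-strict
    ∣ c * s k - c * a ∣          ≡⟨ cong ∣_∣ (factor c (s k) a) ⟩
    ∣ c * (s k - a) ∣            ≡⟨ ∣p*q∣≡∣p∣*∣q∣ c (s k - a) ⟩
    ∣ c ∣ * ∣ s k - a ∣          <⟨ *-monoʳ-<-pos ∣ c ∣ (close k N≤k) ⟩
    ∣ c ∣ * (ε * 1/ ∣ c ∣)       ≡⟨ swap ∣ c ∣ ε (1/ ∣ c ∣) ⟩
    ε * (∣ c ∣ * 1/ ∣ c ∣)       ≡⟨ cong (ε *_) (*-inverseʳ ∣ c ∣) ⟩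
    ε * 1ℚ                       ≡⟨ *-identityʳ ε ⟩
    ε                            ∎
  where
  open ≤-Reasoning
  instance
    ∣c∣-pos : Positive ∣ c ∣
    ∣c∣-pos = ∣p∣-positive c≢0
    ∣c∣-nonZero : NonZero ∣ c ∣
    ∣c∣-nonZero = pos⇒nonZero ∣ c ∣
    1/∣c∣-pos : Positive (1/ ∣ c ∣)
    1/∣c∣-pos = 1/pos⇒pos ∣ c ∣
  factor : ∀ x y z → x * y - x * z ≡ x * (y - z)
  factor = solve-∀ ℚ-ring
  swap : ∀ x y z → x * (y * z) ≡ y * (x * z)
  swap = solve-∀ ℚ-ring

ConvergesTo-unique : ∀ {s a b} → ConvergesTo s a → ConvergesTo s b → a ≡ b
ConvergesTo-unique {s} {a} {b} s→a s→b with a - b ≟ 0ℚ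
... | yes a-b≡0 = x∙y⁻¹≈ε⇒x≈y a b a-b≡0
... | no a-b≢0 =
  let N₁ , close₁ = s→a (δ * ½) δ/2>0
      N₂ , close₂ = s→b (δ * ½) δ/2>0
      k = N₁ ⊔ N₂
  in ⊥-elim (<-irrefl refl (begin-strict
    δ                            ≡⟨ cong ∣_∣ (difference a b (s k)) ⟩
    ∣ (s k - b) - (s k - a) ∣    ≤⟨ ∣p-q∣≤∣p∣+∣q∣ (s k - b) (s k - a) ⟩
    ∣ s k - b ∣ + ∣ s k - a ∣    <⟨ +-mono-< (close₂ k (ℕₚ.m≤n⊔m N₁ N₂)) (close₁ k (ℕₚ.m≤m⊔n N₁ N₂)) ⟩
    δ * ½ + δ * ½                ≡⟨ half+half δ ⟩
    δ                            ∎))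
  where
  open ≤-Reasoning
  δ : ℚ
  δ = ∣ a - b ∣
  instance
    δ-pos : Positive δ
    δ-pos = ∣p∣-positive a-b≢0
  δ/2>0 : 0ℚ < δ * ½
  δ/2>0 = *-monoˡ-<-pos ½ (positive⁻¹ δ)
  difference : ∀ x y z → x - y ≡ (z - y) - (z - x)
  difference = solve-∀ ℚ-ring

ConvergesTo-Σℚ : ∀ {n} {f : Fin n → ℕ → ℚ} {b : Fin n → ℚ} →
  (∀ l → ConvergesTo (f l) (b l)) → ConvergesTo (λ k → Σℚ (λ l → f l k)) (Σℚ b)
ConvergesTo-Σℚ {zero}          f→b = ConvergesTo-const 0ℚ
ConvergesTo-Σℚ {suc n} {f} {b} f→b =
  ConvergesTo-+ {s = f zero} {t = λ k → Σℚ (λ l → f (suc l) k)}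
    (f→b zero) (ConvergesTo-Σℚ {f = f ∘ suc} {b = b ∘ suc} (f→b ∘ suc))

partial-cong : ∀ {s t : ℕ → ℚ} → (∀ k → s k ≡ t k) → ∀ K → partial s K ≡ partial t K
partial-cong s≗t zero    = refl
partial-cong s≗t (suc K) = cong₂ _+_ (partial-cong s≗t K) (s≗t K)

partial-suc : ∀ (s : ℕ → ℚ) K → partial s (suc K) ≡ s 0 + partial (s ∘ suc) K
partial-suc s zero    = trans (+-identityˡ (s 0)) (sym (+-identityʳ (s 0)))
partial-suc s (suc K) = trans (cong (_+ s (suc K)) (partial-suc s K)) (+-assoc (s 0) _ (s (suc K)))

*-distribˡ-partial : ∀ c (s : ℕ → ℚ) K → c * partial s K ≡ partial (λ k → c * s k) K
*-distribˡ-partial c s zero    = *-zeroʳ c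
*-distribˡ-partial c s (suc K) =
  trans (*-distribˡ-+ c (partial s K) (s K)) (cong (_+ c * s K) (*-distribˡ-partial c s K))

partial-Σℚ : ∀ {n} (f : Fin n → ℕ → ℚ) K →
  partial (λ k → Σℚ (λ l → f l k)) K ≡ Σℚ (λ l → partial (f l) K)
partial-Σℚ f zero    = sym (Σℚ-zero {f = λ l → partial (f l) zero} (λ _ → refl))
partial-Σℚ f (suc K) = trans (cong (_+ Σℚ (λ l → f l K)) (partial-Σℚ f K))
                             (sym (Σℚ-distrib-+ (λ l → partial (f l) K) (λ l → f l K)))

ExpectationIs-weighted : ∀ {s b} w → w ≡ 0ℚ ⊎ ExpectationIs s b →
  ExpectationIs (λ k → w * s k) (w * b)
ExpectationIs-weighted {s} {b} w w≡0∨s→b = ConvergesTo-cong (*-distribˡ-partial w s) (limit w≡0∨s→b)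
  where
  limit : w ≡ 0ℚ ⊎ ExpectationIs s b → ConvergesTo (λ K → w * partial s K) (w * b)
  limit (inj₁ refl) = ConvergesTo-0* (partial s) b
  limit (inj₂ s→b)  = ConvergesTo-*ˡ w s→b

ExpectationIs-Σℚ : ∀ {n} {f : Fin n → ℕ → ℚ} {b : Fin n → ℚ} →
  (∀ l → ExpectationIs (f l) (b l)) → ExpectationIs (λ k → Σℚ (λ l → f l k)) (Σℚ b)
ExpectationIs-Σℚ {f = f} f→b = ConvergesTo-cong (sym ∘ partial-Σℚ f) (ConvergesTo-Σℚ f→b)

ExpectationIs-firstStep : ∀ {s t : ℕ → ℚ} {L a} → ExpectationIs s L → ExpectationIs t a →
  (∀ k → s (suc k) ≡ t k) → L ≡ s 0 + a
ExpectationIs-firstStep {s} {t} s→L t→a shift =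
  ConvergesTo-unique {s = partial s ∘ suc} (ConvergesTo-suc {s = partial s} s→L)
    (ConvergesTo-cong (λ K → sym (trans (partial-suc s K) (cong (s 0 +_) (partial-cong shift K))))
      (ConvergesTo-+ {s = λ _ → s 0} {t = partial t} (ConvergesTo-const (s 0)) t→a))

PnbMul≡Σq*M : ∀ {n} (A : Adj n) (M : Fin n → Fin n → Fin n → ℚ) i j v →
  PnbMul A M i j v ≡ Σℚ (λ l → q A i j l * M j l v)
PnbMul≡Σq*M A M i j v = begin
  Σℚ (λ k → Σℚ (λ l → ind (A k l) * (Pnb A i j k l * M k l v)))
      ≡⟨ Σℚ-cong (λ k → Σℚ-cong (λ l → regroup (ind (A k l)) (eqℚ j k) (neq l i) c (M k l v))) ⟩
  Σℚ (λ k → Σℚ (λ l → eqℚ j k * (ind (A k l) * neq l i * c * M k l v)))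
      ≡⟨ Σℚ-cong (λ k → *-distribˡ-Σℚ (eqℚ j k) (λ l → ind (A k l) * neq l i * c * M k l v)) ⟨
  Σℚ (λ k → eqℚ j k * Σℚ (λ l → ind (A k l) * neq l i * c * M k l v))
      ≡⟨ Σℚ-δ j (λ k → Σℚ (λ l → ind (A k l) * neq l i * c * M k l v)) ⟩
  Σℚ (λ l → q A i j l * M j l v) ∎
  where
  open ≡-Reasoning
  c : ℚ
  c = inv (deg A j ∸ 1)
  regroup : ∀ a e b c m → a * (e * b * c * m) ≡ e * (a * b * c * m)
  regroup = solve-∀ ℚ-ring

TtR-diag : ∀ {n} (r : Fin n → ℚ) i j v → TtR r i j v ≡ eqℚ i v * r i
TtR-diag r i j v = Σℚ-δ i (λ x → eqℚ x v * r x)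

module NonBacktracking {n} (A : Adj n) (simple : IsSimpleGraph A) (δ≥2 : ∀ i → 2 ≤ deg A i) where
  open IsSimpleGraph simple

  q-stochastic : ∀ {i j} → A i j ≡ true → Σℚ (q A i j) ≡ 1ℚ
  q-stochastic {i} {j} ij = begin
    Σℚ (q A i j)
        ≡⟨ Σℚ-cong (λ l → *-comm (ind (A j l) * neq l i) c) ⟩
    Σℚ (λ l → c * (ind (A j l) * neq l i))
        ≡⟨ *-distribˡ-Σℚ c (λ l → ind (A j l) * neq l i) ⟨
    c * Σℚ (λ l → ind (A j l) * neq l i)
        ≡⟨ cong (c *_) (Σℚ-except (ind ∘ A j) i) ⟩
    c * (Σℚ (ind ∘ A j) - ind (A j i))
        ≡⟨ cong₂ (λ x y → c * (x - y)) (Σℚ-ind≡deg A j) (cong ind (trans (symmetric j i) ij)) ⟩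
    c * (fromℕ (deg A j) - 1ℚ)
        ≡⟨ cong (c *_) (fromℕ-pred (deg A j) (ℕₚ.<⇒≤ (δ≥2 j))) ⟨
    c * fromℕ (deg A j ∸ 1)
        ≡⟨ inv-*-fromℕ (deg A j ∸ 1) (ℕₚ.∸-monoˡ-≤ 1 (δ≥2 j)) ⟩
    1ℚ ∎
    where
    open ≡-Reasoning
    c : ℚ
    c = inv (deg A j ∸ 1)

  avoidFrom1-suc : ∀ {i j} v k → A i j ≡ true →
    avoidFrom1 A i j v (suc k) ≡ Σℚ (λ l → q A i j l * survHit A j l v k)
  avoidFrom1-suc {i} {j} v k ij = begin
    neq j v * ΣVec k (λ xs → pathProb A i j xs * avoid v xs)
        ≡⟨ cong (neq j v *_) (split-first-vertex k) ⟩
    neq j v * Σℚ (λ l → q A i j l * avoidFrom1 A j l v k)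
        ≡⟨ *-distribˡ-Σℚ (neq j v) (λ l → q A i j l * avoidFrom1 A j l v k) ⟩
    Σℚ (λ l → neq j v * (q A i j l * avoidFrom1 A j l v k))
        ≡⟨ Σℚ-cong (λ l → swap (neq j v) (q A i j l) (avoidFrom1 A j l v k)) ⟩
    Σℚ (λ l → q A i j l * survHit A j l v k) ∎
    where
    open ≡-Reasoning
    swap : ∀ x y z → x * (y * z) ≡ y * (x * z)
    swap = solve-∀ ℚ-ring
    regroup : ∀ x y z w → (x * y) * (z * w) ≡ (x * z) * (y * w)
    regroup = solve-∀ ℚ-ring
    split-first-vertex : ∀ k → ΣVec k (λ xs → pathProb A i j xs * avoid v xs)
                       ≡ Σℚ (λ l → q A i j l * avoidFrom1 A j l v k)
    split-first-vertex zero    = sym (trans (Σℚ-cong (*-identityʳ ∘ q A i j)) (q-stochastic ij))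
    split-first-vertex (suc r) = Σℚ-cong λ l → begin
      ΣVec r (λ xs → (q A i j l * pathProb A j l xs) * (neq l v * avoid v xs))
          ≡⟨ ΣVec-cong r (λ xs → regroup (q A i j l) (pathProb A j l xs) (neq l v) (avoid v xs)) ⟩
      ΣVec r (λ xs → (q A i j l * neq l v) * (pathProb A j l xs * avoid v xs))
          ≡⟨ *-distribˡ-ΣVec r (q A i j l * neq l v) (λ xs → pathProb A j l xs * avoid v xs) ⟨
      (q A i j l * neq l v) * ΣVec r (λ xs → pathProb A j l xs * avoid v xs)
          ≡⟨ *-assoc (q A i j l) (neq l v) _ ⟩
      q A i j l * avoidFrom1 A j l v (suc r) ∎
      where open ≡-Reasoning

  meanReturn-average : ∀ i {c r} → (∀ j → A i j ≡ true → ExpectationIs (survRet A i j) c) →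
    ExpectationIs (survRet₀ A i) r → r ≡ c
  meanReturn-average i {c} {r} ret ret₀ = begin
    r                                      ≡⟨ ConvergesTo-unique {s = partial (survRet₀ A i)} ret₀ average ⟩
    Σℚ (λ x → w x * c)                     ≡⟨ Σℚ-cong (λ x → rotate (ind (A i x)) (inv d) c) ⟩
    Σℚ (λ x → (inv d * c) * ind (A i x))   ≡⟨ *-distribˡ-Σℚ (inv d * c) (ind ∘ A i) ⟨
    (inv d * c) * Σℚ (ind ∘ A i)           ≡⟨ cong ((inv d * c) *_) (Σℚ-ind≡deg A i) ⟩
    (inv d * c) * fromℕ d                  ≡⟨ exchange (inv d) c (fromℕ d) ⟩
    (inv d * fromℕ d) * c                  ≡⟨ cong (_* c) (inv-*-fromℕ d (ℕₚ.<⇒≤ (δ≥2 i))) ⟩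
    1ℚ * c                                 ≡⟨ *-identityˡ c ⟩
    c                                      ∎
    where
    open ≡-Reasoning
    d : ℕ
    d = deg A i
    rotate : ∀ x y z → (x * y) * z ≡ (y * z) * x
    rotate = solve-∀ ℚ-ring
    exchange : ∀ x y z → (x * y) * z ≡ (x * z) * y
    exchange = solve-∀ ℚ-ring
    w : Fin n → ℚ
    w x = ind (A i x) * inv d
    neighbour-or-zero : ∀ x → w x ≡ 0ℚ ⊎ ExpectationIs (survRet A i x) c
    neighbour-or-zero x with A i x in ix
    ... | true  = inj₂ (ret x ix)
    ... | false = inj₁ (*-zeroˡ (inv d))
    average : ExpectationIs (survRet₀ A i) (Σℚ (λ x → w x * c))
    average = ExpectationIs-Σℚ (λ x → ExpectationIs-weighted (w x) (neighbour-or-zero x))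

  module MeanHittingTimes (M : Fin n → Fin n → Fin n → ℚ)
    (M-mean : ∀ i j v → A i j ≡ true → ExpectationIs (survHit A i j v) (M i j v)) where

    ExpectationIs-afterStep : ∀ i j v →
      ExpectationIs (λ k → Σℚ (λ l → q A i j l * survHit A j l v k)) (Σℚ (λ l → q A i j l * M j l v))
    ExpectationIs-afterStep i j v =
      ExpectationIs-Σℚ (λ l → ExpectationIs-weighted (q A i j l) (edge-or-zero l))
      where
      edge-or-zero : ∀ l → q A i j l ≡ 0ℚ ⊎ ExpectationIs (survHit A j l v) (M j l v)
      edge-or-zero l with A j l in jl
      ... | true  = inj₂ (M-mean j l v jl)
      ... | false = inj₁ (trans (cong (_* c) (*-zeroˡ (neq l i))) (*-zeroˡ c))
        where
        c : ℚ
        c = inv (deg A j ∸ 1)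

    meanHitting-firstStep : ∀ {i j} v → A i j ≡ true → M i j v ≡ neq i v * (1ℚ + PnbMul A M i j v)
    meanHitting-firstStep {i} {j} v ij = begin
      M i j v                            ≡⟨ ExpectationIs-firstStep (M-mean i j v ij) afterStep
                                              (λ k → cong (neq i v *_) (avoidFrom1-suc v k ij)) ⟩
      neq i v * 1ℚ + neq i v * S         ≡⟨ *-distribˡ-+ (neq i v) 1ℚ S ⟨
      neq i v * (1ℚ + S)                 ≡⟨ cong (λ x → neq i v * (1ℚ + x)) (PnbMul≡Σq*M A M i j v) ⟨
      neq i v * (1ℚ + PnbMul A M i j v)  ∎
      where
      open ≡-Reasoning
      S : ℚ
      S = Σℚ (λ l → q A i j l * M j l v)
      afterStep : ExpectationIs (λ k → neq i v * Σℚ (λ l → q A i j l * survHit A j l v k)) (neq i v * S)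
      afterStep = ExpectationIs-weighted (neq i v) (inj₂ (ExpectationIs-afterStep i j v))

    meanReturn-firstStep : ∀ {i j c} → A i j ≡ true → ExpectationIs (survRet A i j) c →
      c ≡ 1ℚ + PnbMul A M i j i
    meanReturn-firstStep {i} {j} ij ret =
      trans (ExpectationIs-firstStep ret (ExpectationIs-afterStep i j i) (λ k → avoidFrom1-suc i k ij))
            (cong (1ℚ +_) (sym (PnbMul≡Σq*M A M i j i)))

mainTheorem5 : (n : ℕ) (A : Adj n) → IsSimpleGraph A → Connected A
    → (∀ i → 2 ≤ deg A i) → ¬ IsCycle A → LocallyUniformReturn A
    → (M : Fin n → Fin n → Fin n → ℚ) (r : Fin n → ℚ)
    → (∀ i j v → A i j ≡ true → ExpectationIs (survHit A i j v) (M i j v))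
    → (∀ i → ExpectationIs (survRet₀ A i) (r i))
    → ∀ i j v → A i j ≡ true
    → M i j v ≡ (1ℚ + PnbMul A M i j v) - TtR r i j v
-- Connectivity and not being a cycle only make the expectations finite in the paper;
-- here finiteness is part of the hypotheses on M and r.
mainTheorem5 n A simple _ δ≥2 _ uniform M r M-mean r-mean i j v ij = begin
  M i j v                                  ≡⟨ meanHitting-firstStep v ij ⟩
  neq i v * (1ℚ + PnbMul A M i j v)        ≡⟨ neq*f≡f-eqℚ*f i v (λ v → 1ℚ + PnbMul A M i j v) ⟩
  (1ℚ + PnbMul A M i j v) - eqℚ i v * (1ℚ + PnbMul A M i j i)
                                           ≡⟨ cong (λ x → (1ℚ + PnbMul A M i j v) - eqℚ i v * x) r≡meanReturn ⟨
  (1ℚ + PnbMul A M i j v) - eqℚ i v * r i  ≡⟨ cong (λ x → (1ℚ + PnbMul A M i j v) - x) (TtR-diag r i j v) ⟨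
  (1ℚ + PnbMul A M i j v) - TtR r i j v    ∎
  where
  open ≡-Reasoning
  open NonBacktracking A simple δ≥2
  open MeanHittingTimes M M-mean
  r≡meanReturn : r i ≡ 1ℚ + PnbMul A M i j i
  r≡meanReturn = trans (meanReturn-average i (proj₂ (uniform i)) (r-mean i))
                       (meanReturn-firstStep ij (proj₂ (uniform i) j ij))
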